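{- Let $G=G_1\oplus G_2$ and let $F_1=((x_1,1),\dots,(x_n,1),(y_1,z_1),\dots,(y_m,z_m))$ and $F_2=((x_1',1),\dots,(x_n',1),(y_1',z_1),\dots,(y_m',z_m))$ be factorizations in $G$ (with $x_i,x_i',y_i,y_i'\in G_1$, $z_i\in G_2$). Let $K=\langle x_1,\dots,x_n,y_1,\dots,y_m\rangle\le G_1$ and let $N$ be the normal closure of $\{x_1,\dots,x_n\}$ in $K$. (1) If $F_1$ and $F_2$ are Hurwitz equivalent and $z_i\neq1$ for all $i$, then there is a permutation $\pi\in S_n$ such that for every $i$, $1\le i\le n$, $x_i'$ is conjugate to $x_{\pi(i)}$ in $K$ (in particular $x_i'\in N$). (2) If in addition the stabilizer of $(z_1,\dots,z_m)$ under the Hurwitz braid action is contained in the stabilizer of $(y_1,\dots,y_m)$ (both subgroups of $B_m$), then for every $i$, $1\le i\le m$, there is an element $m_i\in N$ such that $y_i'=y_i^{m_i}$.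
   Context: Conjugation notation: $a^b=b^{ -1}ab$. The braid group $B_k$ (generators $\sigma_1,\dots,\sigma_{k-1}$) acts on the right on tuples of group elements by $(f_1,\dots,f_k)\sigma_i=(f_1,\dots,f_{i-1},f_{i+1},f_{i+1}^{ -1}f_if_{i+1},f_{i+2},\dots,f_k)$, $(f_1,\dots,f_k)\sigma_i^{ -1}=(f_1,\dots,f_{i-1},f_if_{i+1}f_i^{ -1},f_i,f_{i+2},\dots,f_k)$ (Hurwitz braid action); Hurwitz equivalent means in the same orbit. -}

module Defs where

open import Level using (Level; _⊔_)
open import Data.Nat using (ℕ; zero; suc; _+_)
open import Data.Fin using (Fin; zero; suc)
open import Data.Bool using (Bool; true; false)
open import Data.List using (List; []; _∷_)
open import Data.Vec using (Vec; []; _∷_; lookup)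
open import Data.Product using (Σ; ∃; _×_; _,_)
open import Algebra.Bundles using (Group)
import Data.Vec.Relation.Binary.Pointwise.Inductive as PW

module _ {c ℓ : Level} (G : Group c ℓ) where
  open Group G

  _^_ : Carrier → Carrier → Carrier
  a ^ b = (b ⁻¹ ∙ a) ∙ b

  _≋_ : {k : ℕ} → Vec Carrier k → Vec Carrier k → Set (c ⊔ ℓ)
  _≋_ = PW.Pointwise _≈_

  data Gen {p : Level} (S : Carrier → Set p) : Carrier → Set (c ⊔ ℓ ⊔ p) where
    gen : ∀ {x a} → S a → x ≈ a → Gen S x
    one : ∀ {x} → x ≈ ε → Gen S x
    mul : ∀ {x a b} → Gen S a → Gen S b → x ≈ a ∙ b → Gen S x
    inv : ∀ {x a} → Gen S a → x ≈ a ⁻¹ → Gen S x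

  Entry : {k : ℕ} → Vec Carrier k → Carrier → Set c
  Entry v a = ∃ λ i → a ≡ lookup v i
    where open import Relation.Binary.PropositionalEquality using (_≡_)

  Span : {k : ℕ} → Vec Carrier k → Carrier → Set (c ⊔ ℓ)
  Span v = Gen (Entry v)

  NormalClosureIn : {k : ℕ} → (Carrier → Set (c ⊔ ℓ)) → Vec Carrier k → Carrier → Set (c ⊔ ℓ)
  NormalClosureIn K v = Gen (λ a → ∃ λ i → Σ Carrier λ g → K g × a ≈ (lookup v i ^ g))

-- Artin generators of B_k: σ_i (sign true) or σ_i⁻¹ (sign false), 1 ≤ i ≤ k-1
data Letter : ℕ → Set where
  σ : {k : ℕ} → Fin k → Bool → Letter (suc k)

-- braid words in B_k (the action factors through B_k)
BraidWord : ℕ → Set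
BraidWord k = List (Letter k)

module _ {c ℓ : Level} (G : Group c ℓ) where
  open Group G

  private
    act+ : {k : ℕ} → Fin k → Vec Carrier (suc k) → Vec Carrier (suc k)
    act+ zero (a ∷ b ∷ rest) = b ∷ ((b ⁻¹ ∙ a) ∙ b) ∷ rest
    act+ (suc i) (a ∷ rest) = a ∷ act+ i rest

    act- : {k : ℕ} → Fin k → Vec Carrier (suc k) → Vec Carrier (suc k)
    act- zero (a ∷ b ∷ rest) = ((a ∙ b) ∙ a ⁻¹) ∷ a ∷ rest
    act- (suc i) (a ∷ rest) = a ∷ act- i rest

  actLetter : {k : ℕ} → Vec Carrier k → Letter k → Vec Carrier k
  actLetter v (σ i true) = act+ i v
  actLetter v (σ i false) = act- i v

  actWord : {k : ℕ} → Vec Carrier k → BraidWord k → Vec Carrier k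
  actWord v [] = v
  actWord v (l ∷ w) = actWord (actLetter v l) w

  HurwitzEquiv : {k : ℕ} → Vec Carrier k → Vec Carrier k → Set (c ⊔ ℓ)
  HurwitzEquiv F₁ F₂ = ∃ λ (w : BraidWord _) → _≋_ G (actWord F₁ w) F₂

  Stab : {k : ℕ} → Vec Carrier k → BraidWord k → Set (c ⊔ ℓ)
  Stab v w = _≋_ G (actWord v w) v

module Submission where

-- Under the Hurwitz action the G₂-coordinate tells the two kinds of entries apart: an entry
-- with trivial G₂-part stays a K-conjugate of some xᵢ lying in N, while the entries with
-- nontrivial G₂-part stay, in order, N-conjugates of the entries of (y, z) moved by the braid
-- on m strands obtained by forgetting the strands of the trivial entries. This needs only
-- that N is normal in K. Reading the invariant off F₂ gives (1), and shows that the induced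
-- braid fixes z, hence by hypothesis also y, which gives (2).

open import Defs hiding (_^_)
open import Level using (Level; _⊔_)
open import Data.Nat using (ℕ; zero; suc; _+_)
open import Data.Fin using (Fin; zero; suc; _↑ˡ_; _↑ʳ_)
open import Data.Bool using (true; false)
open import Data.List using ([]; _∷_) renaming (_++_ to _++ᴸ_; map to mapᴸ)
open import Data.Vec using (Vec; []; _∷_; zip; replicate; lookup; _++_)
open import Data.Vec.Properties using (lookup-++ˡ; lookup-++ʳ)
import Data.Vec.Relation.Binary.Pointwise.Inductive as Pointwise
open import Data.Product using (Σ; _×_; _,_; proj₁)
open import Data.Unit.Polymorphic using (⊤)
open import Data.Empty using (⊥-elim)
open import Data.Fin.Permutation using (Permutation′; _⟨$⟩ʳ_; _∘ₚ_; lift₀; transpose)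
import Data.Fin.Permutation as Permutation
open import Function using (_∘_)
open import Relation.Nullary using (¬_)
open import Relation.Binary.PropositionalEquality as ≡ using (_≡_; subst; subst₂)
open import Algebra.Bundles using (Group)
open import Algebra.Construct.DirectProduct using (group)

module Conjugation {c ℓ : Level} (G : Group c ℓ) where
  open Group G
  open import Algebra.Properties.Group G
    using (⁻¹-anti-homo-∙; ⁻¹-involutive; ⁻¹-injective; ε⁻¹≈ε; \\-leftDividesˡ)
  open import Relation.Binary.Reasoning.Setoid setoid
  open import Tactic.MonoidSolver using (solve)

  infixl 20 _^_
  _^_ : Carrier → Carrier → Carrier
  _^_ = Defs._^_ G

  ^-cong : ∀ {a b g h} → a ≈ b → g ≈ h → a ^ g ≈ b ^ h
  ^-cong a≈b g≈h = ∙-cong (∙-cong (⁻¹-cong g≈h) a≈b) g≈h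

  ^-identityʳ : ∀ a → a ^ ε ≈ a
  ^-identityʳ a = begin
    (ε ⁻¹ ∙ a) ∙ ε ≈⟨ ∙-congʳ (∙-congʳ ε⁻¹≈ε) ⟩
    (ε ∙ a) ∙ ε    ≈⟨ solve monoid ⟩
    a              ∎

  ε-^ : ∀ g → ε ^ g ≈ ε
  ε-^ g = begin
    (g ⁻¹ ∙ ε) ∙ g ≈⟨ solve monoid ⟩
    g ⁻¹ ∙ g       ≈⟨ inverseˡ g ⟩
    ε              ∎

  ^-∙ : ∀ a g h → a ^ (g ∙ h) ≈ a ^ g ^ h
  ^-∙ a g h = begin
    ((g ∙ h) ⁻¹ ∙ a) ∙ (g ∙ h)    ≈⟨ ∙-congʳ (∙-congʳ (⁻¹-anti-homo-∙ g h)) ⟩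
    ((h ⁻¹ ∙ g ⁻¹) ∙ a) ∙ (g ∙ h) ≈⟨ solve monoid ⟩
    (h ⁻¹ ∙ ((g ⁻¹ ∙ a) ∙ g)) ∙ h ∎

  ∙-^ : ∀ a b g → (a ∙ b) ^ g ≈ a ^ g ∙ b ^ g
  ∙-^ a b g = begin
    (g ⁻¹ ∙ (a ∙ b)) ∙ g                 ≈⟨ solve monoid ⟩
    ((g ⁻¹ ∙ a) ∙ ε) ∙ (b ∙ g)           ≈⟨ ∙-congʳ (∙-congˡ (inverseʳ g)) ⟨
    ((g ⁻¹ ∙ a) ∙ (g ∙ g ⁻¹)) ∙ (b ∙ g)  ≈⟨ solve monoid ⟩
    ((g ⁻¹ ∙ a) ∙ g) ∙ ((g ⁻¹ ∙ b) ∙ g)  ∎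

  ⁻¹-^ : ∀ a g → (a ⁻¹) ^ g ≈ (a ^ g) ⁻¹
  ⁻¹-^ a g = sym (begin
    ((g ⁻¹ ∙ a) ∙ g) ⁻¹       ≈⟨ ⁻¹-anti-homo-∙ _ _ ⟩
    g ⁻¹ ∙ (g ⁻¹ ∙ a) ⁻¹      ≈⟨ ∙-congˡ (⁻¹-anti-homo-∙ _ _) ⟩
    g ⁻¹ ∙ (a ⁻¹ ∙ g ⁻¹ ⁻¹)   ≈⟨ ∙-congˡ (∙-congˡ (⁻¹-involutive g)) ⟩
    g ⁻¹ ∙ (a ⁻¹ ∙ g)         ≈⟨ solve monoid ⟩
    (g ⁻¹ ∙ a ⁻¹) ∙ g         ∎)

  ^-inverse : ∀ a g → a ^ g ^ (g ⁻¹) ≈ a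
  ^-inverse a g = begin
    a ^ g ^ (g ⁻¹)  ≈⟨ ^-∙ a g (g ⁻¹) ⟨
    a ^ (g ∙ g ⁻¹)  ≈⟨ ^-cong refl (inverseʳ g) ⟩
    a ^ ε           ≈⟨ ^-identityʳ a ⟩
    a               ∎

  ^≈ε⇒≈ε : ∀ {a g} → a ^ g ≈ ε → a ≈ ε
  ^≈ε⇒≈ε {a} {g} a^g≈ε = begin
    a               ≈⟨ ^-inverse a g ⟨
    a ^ g ^ (g ⁻¹)  ≈⟨ ^-cong a^g≈ε refl ⟩
    ε ^ (g ⁻¹)      ≈⟨ ε-^ (g ⁻¹) ⟩
    ε               ∎

  ⁻¹≈ε⇒≈ε : ∀ {a} → a ⁻¹ ≈ ε → a ≈ ε
  ⁻¹≈ε⇒≈ε a⁻¹≈ε = ⁻¹-injective (trans a⁻¹≈ε (sym ε⁻¹≈ε))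

  ∙-∙⁻¹≈^⁻¹ : ∀ a b → (a ∙ b) ∙ a ⁻¹ ≈ b ^ (a ⁻¹)
  ∙-∙⁻¹≈^⁻¹ a b = ∙-congʳ (∙-congʳ (sym (⁻¹-involutive a)))

  ^-rebase : ∀ a g h → a ^ h ≈ a ^ g ^ (g ⁻¹ ∙ h)
  ^-rebase a g h = begin
    a ^ h                 ≈⟨ ^-cong refl (\\-leftDividesˡ g h) ⟨
    a ^ (g ∙ (g ⁻¹ ∙ h))  ≈⟨ ^-∙ a g (g ⁻¹ ∙ h) ⟩
    a ^ g ^ (g ⁻¹ ∙ h)    ∎

  ⁻¹∙[∙^]≈^∙ : ∀ g a b → g ⁻¹ ∙ (a ∙ g ^ b) ≈ (a ∙ b ⁻¹) ^ g ∙ b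
  ⁻¹∙[∙^]≈^∙ g a b = solve monoid

module Subgroups {c ℓ : Level} (G : Group c ℓ) where
  open Group G
  open Conjugation G

  record IsSubgroup {p : Level} (P : Carrier → Set p) : Set (c ⊔ ℓ ⊔ p) where
    field
      ∈-resp : ∀ {a b} → a ≈ b → P b → P a
      ε-∈ : P ε
      ∙-∈ : ∀ {a b} → P a → P b → P (a ∙ b)
      ⁻¹-∈ : ∀ {a} → P a → P (a ⁻¹)

    ^-∈ : ∀ {a g} → P a → P g → P (a ^ g)
    ^-∈ a∈P g∈P = ∙-∈ (∙-∈ (⁻¹-∈ g∈P) a∈P) g∈P

  open IsSubgroup public

  Gen-isSubgroup : ∀ {p} {S : Carrier → Set p} → IsSubgroup (Gen G S)
  Gen-isSubgroup = record
    { ∈-resp = λ a≈b b∈ → mul b∈ (one refl) (trans a≈b (sym (identityʳ _)))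
    ; ε-∈ = one refl
    ; ∙-∈ = λ a∈ b∈ → mul a∈ b∈ refl
    ; ⁻¹-∈ = λ a∈ → inv a∈ refl
    }

  Span-lookup : ∀ {k} (v : Vec Carrier k) i → Span G v (lookup v i)
  Span-lookup v i = gen (i , ≡.refl) refl

  ConjugateIn : ∀ {p} → (Carrier → Set p) → Carrier → Carrier → Set (c ⊔ ℓ ⊔ p)
  ConjugateIn P a b = Σ Carrier λ g → P g × a ≈ b ^ g

  module _ {p} {P : Carrier → Set p} where

    ConjugateIn-respˡ : ∀ {a a′ b} → a ≈ a′ → ConjugateIn P a′ b → ConjugateIn P a b
    ConjugateIn-respˡ a≈a′ (g , g∈P , a′≈b^g) = g , g∈P , trans a≈a′ a′≈b^g

    ConjugateIn-respʳ : ∀ {a b b′} → b ≈ b′ → ConjugateIn P a b → ConjugateIn P a b′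
    ConjugateIn-respʳ b≈b′ (g , g∈P , a≈b^g) = g , g∈P , trans a≈b^g (^-cong b≈b′ refl)

    ConjugateIn-⁻¹ : ∀ {a b} → ConjugateIn P a b → ConjugateIn P (a ⁻¹) (b ⁻¹)
    ConjugateIn-⁻¹ {b = b} (g , g∈P , a≈b^g) =
      g , g∈P , trans (⁻¹-cong a≈b^g) (sym (⁻¹-^ b g))

    module _ (P-sub : IsSubgroup P) where

      ConjugateIn-refl : ∀ a → ConjugateIn P a a
      ConjugateIn-refl a = ε , ε-∈ P-sub , sym (^-identityʳ a)

      ConjugateIn-^ : ∀ {a b h} → ConjugateIn P a b → P h → ConjugateIn P (a ^ h) b
      ConjugateIn-^ {b = b} {h} (g , g∈P , a≈b^g) h∈P =
        g ∙ h , ∙-∈ P-sub g∈P h∈P , trans (^-cong a≈b^g refl) (sym (^-∙ b g h))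

      ConjugateIn-∈ : ∀ {q} {Q : Carrier → Set q} → IsSubgroup Q → (∀ {g} → P g → Q g) →
        ∀ {a b} → ConjugateIn P a b → Q b → Q a
      ConjugateIn-∈ Q-sub P⊆Q (g , g∈P , a≈b^g) b∈Q =
        ∈-resp Q-sub a≈b^g (^-∈ Q-sub b∈Q (P⊆Q g∈P))

  module _ {p q} {K : Carrier → Set p} {N : Carrier → Set q} (N-sub : IsSubgroup N)
    (N-normal : ∀ {a g} → N a → K g → N (a ^ g)) where

    -- With t = ρ ^ ν and u = ρ′ ^ ν′, the conjugator is
    -- ρ′ ⁻¹ ∙ (ν ∙ u) = (ν ∙ ν′ ⁻¹) ^ ρ′ ∙ ν′.
    ConjugateIn-^-ConjugateIn : ∀ {t u ρ ρ′} → K ρ′ →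
      ConjugateIn N t ρ → ConjugateIn N u ρ′ → ConjugateIn N (t ^ u) (ρ ^ ρ′)
    ConjugateIn-^-ConjugateIn {t} {u} {ρ} {ρ′} ρ′∈K
      (ν , ν∈N , t≈ρ^ν) (ν′ , ν′∈N , u≈ρ′^ν′) =
      ρ′ ⁻¹ ∙ (ν ∙ u) , conjugator∈N , t^u≈
      where
      conjugator∈N : N (ρ′ ⁻¹ ∙ (ν ∙ u))
      conjugator∈N = ∈-resp N-sub
        (trans (∙-congˡ (∙-congˡ u≈ρ′^ν′)) (⁻¹∙[∙^]≈^∙ ρ′ ν ν′))
        (∙-∈ N-sub (N-normal (∙-∈ N-sub ν∈N (⁻¹-∈ N-sub ν′∈N)) ρ′∈K) ν′∈N)

      t^u≈ : t ^ u ≈ ρ ^ ρ′ ^ (ρ′ ⁻¹ ∙ (ν ∙ u))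
      t^u≈ = begin
        t ^ u                      ≈⟨ ^-cong t≈ρ^ν refl ⟩
        ρ ^ ν ^ u                  ≈⟨ ^-∙ ρ ν u ⟨
        ρ ^ (ν ∙ u)                ≈⟨ ^-rebase ρ ρ′ (ν ∙ u) ⟩
        ρ ^ ρ′ ^ (ρ′ ⁻¹ ∙ (ν ∙ u)) ∎
        where open import Relation.Binary.Reasoning.Setoid setoid

  module NormalClosure {K : Carrier → Set (c ⊔ ℓ)} (K-sub : IsSubgroup K)
    {k} (v : Vec Carrier k) (v⊆K : ∀ i → K (lookup v i)) where

    private
      N : Carrier → Set (c ⊔ ℓ)
      N = NormalClosureIn G K v

    NormalClosure-lookup : ∀ i → N (lookup v i)
    NormalClosure-lookup i = gen (i , ConjugateIn-refl K-sub (lookup v i)) refl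

    NormalClosure⊆ : ∀ {a} → N a → K a
    NormalClosure⊆ (gen (i , conj) a≈) =
      ∈-resp K-sub a≈ (ConjugateIn-∈ K-sub K-sub (λ g∈K → g∈K) conj (v⊆K i))
    NormalClosure⊆ (one a≈ε) = ∈-resp K-sub a≈ε (ε-∈ K-sub)
    NormalClosure⊆ (mul a∈ b∈ a≈) =
      ∈-resp K-sub a≈ (∙-∈ K-sub (NormalClosure⊆ a∈) (NormalClosure⊆ b∈))
    NormalClosure⊆ (inv a∈ a≈) = ∈-resp K-sub a≈ (⁻¹-∈ K-sub (NormalClosure⊆ a∈))

    NormalClosure-normal : ∀ {a g} → N a → K g → N (a ^ g)
    NormalClosure-normal (gen (i , conj) a≈) g∈K =
      gen (i , ConjugateIn-^ K-sub (ConjugateIn-respˡ a≈ conj) g∈K) refl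
    NormalClosure-normal (one a≈ε) g∈K = one (trans (^-cong a≈ε refl) (ε-^ _))
    NormalClosure-normal (mul a∈ b∈ a≈) g∈K =
      mul (NormalClosure-normal a∈ g∈K) (NormalClosure-normal b∈ g∈K)
        (trans (^-cong a≈ refl) (∙-^ _ _ _))
    NormalClosure-normal (inv a∈ a≈) g∈K =
      inv (NormalClosure-normal a∈ g∈K) (trans (^-cong a≈ refl) (⁻¹-^ _ _))

shiftLetter : ∀ {k} → Letter k → Letter (suc k)
shiftLetter (σ i sign) = σ (suc i) sign

module HurwitzAction {c ℓ : Level} (G : Group c ℓ) where
  open Group G using (Carrier)
  open ≡.≡-Reasoning

  actLetter-shift : ∀ {k} a (v : Vec Carrier k) (l : Letter k) →
    actLetter G (a ∷ v) (shiftLetter l) ≡ a ∷ actLetter G v l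
  actLetter-shift a v (σ i true) = ≡.refl
  actLetter-shift a v (σ i false) = ≡.refl

  actWord-shift : ∀ {k} a (v : Vec Carrier k) (w : BraidWord k) →
    actWord G (a ∷ v) (mapᴸ shiftLetter w) ≡ a ∷ actWord G v w
  actWord-shift a v [] = ≡.refl
  actWord-shift a v (l ∷ w) = begin
    actWord G (actLetter G (a ∷ v) (shiftLetter l)) (mapᴸ shiftLetter w)
      ≡⟨ ≡.cong (λ v′ → actWord G v′ (mapᴸ shiftLetter w)) (actLetter-shift a v l) ⟩
    actWord G (a ∷ actLetter G v l) (mapᴸ shiftLetter w)
      ≡⟨ actWord-shift a (actLetter G v l) w ⟩
    a ∷ actWord G (actLetter G v l) w ∎

  actWord-++ : ∀ {k} (v : Vec Carrier k) (w w′ : BraidWord k) →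
    actWord G v (w ++ᴸ w′) ≡ actWord G (actWord G v w) w′
  actWord-++ v [] w′ = ≡.refl
  actWord-++ v (l ∷ w) w′ = actWord-++ (actLetter G v l) w w′

data Interleaving : ℕ → ℕ → ℕ → Set where
  [] : Interleaving 0 0 0
  left : ∀ {a b k} → Interleaving a b k → Interleaving (suc a) b (suc k)
  right : ∀ {a b k} → Interleaving a b k → Interleaving a (suc b) (suc k)

rights : ∀ b → Interleaving 0 b b
rights zero = []
rights (suc b) = right (rights b)

leftsThenRights : ∀ a b → Interleaving a b (a + b)
leftsThenRights zero b = rights b
leftsThenRights (suc a) b = left (leftsThenRights a b)

module Tracking {c₁ ℓ₁ c₂ ℓ₂ p q : Level} (G₁ : Group c₁ ℓ₁) (G₂ : Group c₂ ℓ₂)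
  {K : Group.Carrier G₁ → Set p} {N : Group.Carrier G₁ → Set q}
  (K-sub : Subgroups.IsSubgroup G₁ K) (N-sub : Subgroups.IsSubgroup G₁ N)
  (N⊆K : ∀ {a} → N a → K a)
  (N-normal : ∀ {a g} → N a → K g → N (Conjugation._^_ G₁ a g)) where

  private
    module A = Group G₁
    module B = Group G₂
    module B^ = Conjugation G₂
    module P = Group (group G₁ G₂)
    module P^ = Conjugation (group G₁ G₂)
    L = c₁ ⊔ ℓ₁ ⊔ ℓ₂ ⊔ p ⊔ q

  open Conjugation G₁
  open Subgroups G₁
  open HurwitzAction
  open import Algebra.Properties.Group using (ε⁻¹≈ε)

  XEntry : P.Carrier → A.Carrier → Set L
  XEntry (t₁ , t₂) a = t₂ B.≈ B.ε × N t₁ × ConjugateIn K t₁ a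

  YEntry : P.Carrier → A.Carrier → B.Carrier → Set L
  YEntry (t₁ , t₂) ρ ζ = t₂ B.≈ ζ × ¬ ζ B.≈ B.ε × K ρ × ConjugateIn N t₁ ρ

  XEntry-resp : ∀ {t u a} → t P.≈ u → XEntry u a → XEntry t a
  XEntry-resp (t≈u₁ , t≈u₂) (u₂≈ε , u₁∈N , u₁∼a) =
    B.trans t≈u₂ u₂≈ε , ∈-resp N-sub t≈u₁ u₁∈N , ConjugateIn-respˡ t≈u₁ u₁∼a

  YEntry-resp : ∀ {t u ρ ρ′ ζ ζ′} → t P.≈ u → ρ A.≈ ρ′ → ζ B.≈ ζ′ →
    YEntry u ρ′ ζ′ → YEntry t ρ ζ
  YEntry-resp (t≈u₁ , t≈u₂) ρ≈ρ′ ζ≈ζ′ (u₂≈ζ′ , ζ′≉ε , ρ′∈K , u₁∼ρ′) =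
    B.trans t≈u₂ (B.trans u₂≈ζ′ (B.sym ζ≈ζ′)) ,
    (λ ζ≈ε → ζ′≉ε (B.trans (B.sym ζ≈ζ′) ζ≈ε)) ,
    ∈-resp K-sub ρ≈ρ′ ρ′∈K ,
    ConjugateIn-respʳ (A.sym ρ≈ρ′) (ConjugateIn-respˡ t≈u₁ u₁∼ρ′)

  XEntry-K : ∀ {t a} → XEntry t a → K (proj₁ t)
  XEntry-K (_ , t₁∈N , _) = N⊆K t₁∈N

  YEntry-K : ∀ {t ρ ζ} → YEntry t ρ ζ → K (proj₁ t)
  YEntry-K (_ , _ , ρ∈K , t₁∼ρ) = ConjugateIn-∈ N-sub K-sub N⊆K t₁∼ρ ρ∈K

  XEntry-^ : ∀ {t a} h → XEntry t a → K (proj₁ h) → XEntry (t P^.^ h) a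
  XEntry-^ h (t₂≈ε , t₁∈N , t₁∼a) h₁∈K =
    B.trans (B^.^-cong t₂≈ε B.refl) (B^.ε-^ _) ,
    N-normal t₁∈N h₁∈K , ConjugateIn-^ K-sub t₁∼a h₁∈K

  YEntry-^-XEntry : ∀ {t u ρ ζ a} → YEntry t ρ ζ → XEntry u a → YEntry (t P^.^ u) ρ ζ
  YEntry-^-XEntry (t₂≈ζ , ζ≉ε , ρ∈K , t₁∼ρ) (u₂≈ε , u₁∈N , _) =
    B.trans (B^.^-cong t₂≈ζ u₂≈ε) (B^.^-identityʳ _) ,
    ζ≉ε , ρ∈K , ConjugateIn-^ N-sub t₁∼ρ u₁∈N

  YEntry-^-YEntry : ∀ {t u ρ ρ′ ζ ζ′} → YEntry t ρ ζ → YEntry u ρ′ ζ′ →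
    YEntry (t P^.^ u) (ρ ^ ρ′) (ζ B^.^ ζ′)
  YEntry-^-YEntry (t₂≈ζ , ζ≉ε , ρ∈K , t₁∼ρ) (u₂≈ζ′ , _ , ρ′∈K , u₁∼ρ′) =
    B^.^-cong t₂≈ζ u₂≈ζ′ , (λ ζ^ζ′≈ε → ζ≉ε (B^.^≈ε⇒≈ε ζ^ζ′≈ε)) ,
    ^-∈ K-sub ρ∈K ρ′∈K ,
    ConjugateIn-^-ConjugateIn N-sub N-normal ρ′∈K t₁∼ρ u₁∼ρ′

  XEntry-⁻¹ : ∀ {t a} → XEntry t a → XEntry (t P.⁻¹) (a A.⁻¹)
  XEntry-⁻¹ (t₂≈ε , t₁∈N , t₁∼a) =
    B.trans (B.⁻¹-cong t₂≈ε) (ε⁻¹≈ε G₂) ,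
    ⁻¹-∈ N-sub t₁∈N , ConjugateIn-⁻¹ t₁∼a

  YEntry-⁻¹ : ∀ {t ρ ζ} → YEntry t ρ ζ → YEntry (t P.⁻¹) (ρ A.⁻¹) (ζ B.⁻¹)
  YEntry-⁻¹ (t₂≈ζ , ζ≉ε , ρ∈K , t₁∼ρ) =
    B.⁻¹-cong t₂≈ζ , (λ ζ⁻¹≈ε → ζ≉ε (B^.⁻¹≈ε⇒≈ε ζ⁻¹≈ε)) ,
    ⁻¹-∈ K-sub ρ∈K , ConjugateIn-⁻¹ t₁∼ρ

  -- f gives the element each XEntry is conjugate to; R and Z are y and z moved by the braid
  -- induced on the YEntries.
  Tracked : ∀ {a b k} → Interleaving a b k → Vec P.Carrier k → (Fin a → A.Carrier) →
    Vec A.Carrier b → Vec B.Carrier b → Set L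
  Tracked [] [] f [] [] = ⊤
  Tracked (left s) (t ∷ T) f R Z = XEntry t (f zero) × Tracked s T (f ∘ suc) R Z
  Tracked (right s) (t ∷ T) f (ρ ∷ R) (ζ ∷ Z) = YEntry t ρ ζ × Tracked s T f R Z

  Trackable : ∀ {a b k} → Vec P.Carrier k → (Fin a → A.Carrier) →
    Vec A.Carrier b → Vec B.Carrier b → Set L
  Trackable {a} {b} {k} T f R Z =
    Σ (Interleaving a b k) λ s → Σ (Permutation′ a) λ π → Σ (BraidWord b) λ w →
      Tracked s T (f ∘ (π ⟨$⟩ʳ_)) (actWord G₁ R w) (actWord G₂ Z w)

  trackable-∷ˡ : ∀ {a b k t} {T : Vec P.Carrier k} {f : Fin (suc a) → A.Carrier}
    {R : Vec A.Carrier b} {Z} →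
    XEntry t (f zero) → Trackable T (f ∘ suc) R Z → Trackable (t ∷ T) f R Z
  trackable-∷ˡ t∈X (s , π , w , tracked) = left s , lift₀ π , w , t∈X , tracked

  trackable-∷ʳ : ∀ {a b k t ρ ζ} {T : Vec P.Carrier k} {f : Fin a → A.Carrier}
    {R : Vec A.Carrier b} {Z} →
    YEntry t ρ ζ → Trackable T f R Z → Trackable (t ∷ T) f (ρ ∷ R) (ζ ∷ Z)
  trackable-∷ʳ {t = t} {ρ} {ζ} {T} {f} {R} {Z} t∈Y (s , π , w , tracked) =
    right s , π , mapᴸ shiftLetter w ,
    subst₂ (Tracked (right s) (t ∷ T) (f ∘ (π ⟨$⟩ʳ_)))
      (≡.sym (actWord-shift G₁ ρ R w)) (≡.sym (actWord-shift G₂ ζ Z w)) (t∈Y , tracked)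

  trackable-actLetter : ∀ {a b k} (s : Interleaving a b k) T f R Z (l : Letter k) →
    Tracked s T f R Z → Trackable (actLetter (group G₁ G₂) T l) f R Z
  trackable-actLetter (left []) _ _ _ _ (σ () _) _
  trackable-actLetter (right []) _ _ _ _ (σ () _) _
  trackable-actLetter (left (left s)) (t ∷ u ∷ T) f R Z (σ zero true) (t∈X , u∈X , tracked) =
    left (left s) , transpose zero (suc zero) , [] , u∈X , XEntry-^ u t∈X (XEntry-K u∈X) , tracked
  trackable-actLetter (left (left s)) (t ∷ u ∷ T) f R Z (σ zero false) (t∈X , u∈X , tracked) =
    left (left s) , transpose zero (suc zero) , [] ,
    XEntry-resp (P^.∙-∙⁻¹≈^⁻¹ t u) (XEntry-^ (t P.⁻¹) u∈X (⁻¹-∈ K-sub (XEntry-K t∈X))) ,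
    t∈X , tracked
  trackable-actLetter (left (right s)) (t ∷ u ∷ T) f (ρ ∷ R) (ζ ∷ Z) (σ zero true)
      (t∈X , u∈Y , tracked) =
    right (left s) , Permutation.id , [] , u∈Y , XEntry-^ u t∈X (YEntry-K u∈Y) , tracked
  trackable-actLetter (left (right s)) (t ∷ u ∷ T) f (ρ ∷ R) (ζ ∷ Z) (σ zero false)
      (t∈X , u∈Y , tracked) =
    right (left s) , Permutation.id , [] ,
    YEntry-resp (P^.∙-∙⁻¹≈^⁻¹ t u) A.refl B.refl (YEntry-^-XEntry u∈Y (XEntry-⁻¹ t∈X)) ,
    t∈X , tracked
  trackable-actLetter (right (left s)) (t ∷ u ∷ T) f (ρ ∷ R) (ζ ∷ Z) (σ zero true)
      (t∈Y , u∈X , tracked) =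
    left (right s) , Permutation.id , [] , u∈X , YEntry-^-XEntry t∈Y u∈X , tracked
  trackable-actLetter (right (left s)) (t ∷ u ∷ T) f (ρ ∷ R) (ζ ∷ Z) (σ zero false)
      (t∈Y , u∈X , tracked) =
    left (right s) , Permutation.id , [] ,
    XEntry-resp (P^.∙-∙⁻¹≈^⁻¹ t u) (XEntry-^ (t P.⁻¹) u∈X (⁻¹-∈ K-sub (YEntry-K t∈Y))) ,
    t∈Y , tracked
  trackable-actLetter (right (right s)) (t ∷ u ∷ T) f (ρ ∷ ρ′ ∷ R) (ζ ∷ ζ′ ∷ Z) (σ zero true)
      (t∈Y , u∈Y , tracked) =
    right (right s) , Permutation.id , σ zero true ∷ [] , u∈Y , YEntry-^-YEntry t∈Y u∈Y , tracked
  trackable-actLetter (right (right s)) (t ∷ u ∷ T) f (ρ ∷ ρ′ ∷ R) (ζ ∷ ζ′ ∷ Z) (σ zero false)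
      (t∈Y , u∈Y , tracked) =
    right (right s) , Permutation.id , σ zero false ∷ [] ,
    YEntry-resp (P^.∙-∙⁻¹≈^⁻¹ t u) (∙-∙⁻¹≈^⁻¹ ρ ρ′) (B^.∙-∙⁻¹≈^⁻¹ ζ ζ′)
      (YEntry-^-YEntry u∈Y (YEntry-⁻¹ t∈Y)) ,
    t∈Y , tracked
  trackable-actLetter (left s) (t ∷ T) f R Z (σ (suc i) sign) (t∈X , tracked) =
    subst (λ T′ → Trackable T′ f R Z)
      (≡.sym (actLetter-shift (group G₁ G₂) t T (σ i sign)))
      (trackable-∷ˡ {f = f} t∈X (trackable-actLetter s T (f ∘ suc) R Z (σ i sign) tracked))
  trackable-actLetter (right s) (t ∷ T) f (ρ ∷ R) (ζ ∷ Z) (σ (suc i) sign) (t∈Y , tracked) =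
    subst (λ T′ → Trackable T′ f (ρ ∷ R) (ζ ∷ Z))
      (≡.sym (actLetter-shift (group G₁ G₂) t T (σ i sign)))
      (trackable-∷ʳ {f = f} t∈Y (trackable-actLetter s T f R Z (σ i sign) tracked))

  trackable-actWord : ∀ {a b k} {s : Interleaving a b k} {T f R Z} → Tracked s T f R Z →
    (w : BraidWord k) → Trackable (actWord (group G₁ G₂) T w) f R Z
  trackable-actWord tracked [] = _ , Permutation.id , [] , tracked
  trackable-actWord {s = s} {T} {f} {R} {Z} tracked (l ∷ w)
    with trackable-actLetter s T f R Z l tracked
  ... | s₁ , π₁ , w₁ , tracked₁ with trackable-actWord tracked₁ w
  ... | s₂ , π₂ , w₂ , tracked₂ =
    s₂ , π₂ ∘ₚ π₁ , w₁ ++ᴸ w₂ ,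
    subst₂ (Tracked s₂ (actWord (group G₁ G₂) T (l ∷ w)) (f ∘ ((π₂ ∘ₚ π₁) ⟨$⟩ʳ_)))
      (≡.sym (actWord-++ G₁ R w₁ w₂)) (≡.sym (actWord-++ G₂ Z w₁ w₂)) tracked₂

  tracked-rights : ∀ {b} (f : Fin 0 → A.Carrier) (y : Vec A.Carrier b) (z : Vec B.Carrier b) →
    (∀ i → K (lookup y i)) → (∀ i → ¬ lookup z i B.≈ B.ε) → Tracked (rights b) (zip y z) f y z
  tracked-rights f [] [] _ _ = _
  tracked-rights f (η ∷ y) (ζ ∷ z) y⊆K z≉ε =
    (B.refl , z≉ε zero , y⊆K zero , ConjugateIn-refl N-sub η) ,
    tracked-rights f y z (y⊆K ∘ suc) (z≉ε ∘ suc)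

  tracked-start : ∀ {a b} (x : Vec A.Carrier a) (y : Vec A.Carrier b) (z : Vec B.Carrier b) →
    (∀ i → N (lookup x i)) → (∀ i → K (lookup y i)) → (∀ i → ¬ lookup z i B.≈ B.ε) →
    Tracked (leftsThenRights a b) (zip x (replicate a B.ε) ++ zip y z) (lookup x) y z
  tracked-start [] y z _ y⊆K z≉ε = tracked-rights (lookup []) y z y⊆K z≉ε
  tracked-start (ξ ∷ x) y z x⊆N y⊆K z≉ε =
    (B.refl , x⊆N zero , ConjugateIn-refl K-sub ξ) , tracked-start x y z (x⊆N ∘ suc) y⊆K z≉ε

  Tracked-≋-rights : ∀ {b} (s : Interleaving 0 b b) {T f} R Z
    (y : Vec A.Carrier b) (z : Vec B.Carrier b) →
    Tracked s T f R Z → _≋_ (group G₁ G₂) T (zip y z) →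
    _≋_ G₂ Z z × (∀ i → ConjugateIn N (lookup y i) (lookup R i))
  Tracked-≋-rights [] [] [] [] [] _ Pointwise.[] = Pointwise.[] , λ ()
  Tracked-≋-rights (right s) (ρ ∷ R) (ζ ∷ Z) (η ∷ y) (ζ′ ∷ z)
    ((t₂≈ζ , _ , _ , t₁∼ρ) , tracked) ((t₁≈η , t₂≈ζ′) Pointwise.∷ T≋)
    with Tracked-≋-rights s R Z y z tracked T≋
  ... | Z≋z , y∼R =
    B.trans (B.sym t₂≈ζ) t₂≈ζ′ Pointwise.∷ Z≋z ,
    λ { zero → ConjugateIn-respˡ (A.sym t₁≈η) t₁∼ρ ; (suc i) → y∼R i }

  Tracked-≋ : ∀ {a b} (s : Interleaving a b (a + b)) {T f} R Z
    (x : Vec A.Carrier a) (y : Vec A.Carrier b) (z : Vec B.Carrier b) →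
    Tracked s T f R Z → _≋_ (group G₁ G₂) T (zip x (replicate a B.ε) ++ zip y z) →
    (∀ i → ConjugateIn K (lookup x i) (f i)) × _≋_ G₂ Z z ×
    (∀ i → ConjugateIn N (lookup y i) (lookup R i))
  Tracked-≋ s R Z [] y z tracked T≋ = (λ ()) , Tracked-≋-rights s R Z y z tracked T≋
  Tracked-≋ (left s) R Z (ξ ∷ x) y z ((_ , _ , t₁∼) , tracked) ((t₁≈ξ , _) Pointwise.∷ T≋)
    with Tracked-≋ s R Z x y z tracked T≋
  ... | x∼f , Z≋z , y∼R =
    (λ { zero → ConjugateIn-respˡ (A.sym t₁≈ξ) t₁∼ ; (suc i) → x∼f i }) , Z≋z , y∼R
  -- An entry of the first block has trivial G₂-part, so it cannot be tracked as a YEntry.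
  Tracked-≋ (right s) (ρ ∷ R) (ζ ∷ Z) (ξ ∷ x) y z
    ((t₂≈ζ , ζ≉ε , _) , _) ((_ , t₂≈ε) Pointwise.∷ _) =
    ⊥-elim (ζ≉ε (B.trans (B.sym t₂≈ζ) t₂≈ε))

  record HurwitzInvariants {a b} (x x′ : Vec A.Carrier a) (y y′ : Vec A.Carrier b)
    (z : Vec B.Carrier b) : Set (c₂ ⊔ L) where
    field
      permutation : Permutation′ a
      braid : BraidWord b
      x′-conjugate : ∀ i → ConjugateIn K (lookup x′ i) (lookup x (permutation ⟨$⟩ʳ i))
      z-fixed : Stab G₂ z braid
      y′-conjugate : ∀ i → ConjugateIn N (lookup y′ i) (lookup (actWord G₁ y braid) i)

  hurwitzEquiv⇒invariants : ∀ {a b} (x x′ : Vec A.Carrier a) (y y′ : Vec A.Carrier b)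
    (z : Vec B.Carrier b) →
    (∀ i → N (lookup x i)) → (∀ i → K (lookup y i)) → (∀ i → ¬ lookup z i B.≈ B.ε) →
    HurwitzEquiv (group G₁ G₂)
      (zip x (replicate a B.ε) ++ zip y z) (zip x′ (replicate a B.ε) ++ zip y′ z) →
    HurwitzInvariants x x′ y y′ z
  hurwitzEquiv⇒invariants x x′ y y′ z x⊆N y⊆K z≉ε (w , F₁w≋F₂)
    with trackable-actWord (tracked-start x y z x⊆N y⊆K z≉ε) w
  ... | s , π , w′ , tracked with Tracked-≋ s _ _ x′ y′ z tracked F₁w≋F₂
  ... | x′∼x , Zw′≋z , y′∼yw′ = record
    { permutation = π ; braid = w′ ; x′-conjugate = x′∼x
    ; z-fixed = Zw′≋z ; y′-conjugate = y′∼yw′ }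

open Defs using (_^_)

theorem3p5 : {c₁ ℓ₁ c₂ ℓ₂ : Level} (G₁ : Group c₁ ℓ₁) (G₂ : Group c₂ ℓ₂) (n m : ℕ)
    (x x′ : Vec (Group.Carrier G₁) n) (y y′ : Vec (Group.Carrier G₁) m) (z : Vec (Group.Carrier G₂) m) →
    HurwitzEquiv (group G₁ G₂)
      (zip x (replicate n (Group.ε G₂)) ++ zip y z)
      (zip x′ (replicate n (Group.ε G₂)) ++ zip y′ z) →
    ((i : Fin m) → ¬ (Group._≈_ G₂ (lookup z i) (Group.ε G₂))) →
    (Σ (Permutation′ n) λ π → (i : Fin n) →
        Σ (Group.Carrier G₁) λ k → Span G₁ (x ++ y) k ×
          Group._≈_ G₁ (lookup x′ i) (_^_ G₁ (lookup x (π ⟨$⟩ʳ i)) k))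
    ×
    (((w : BraidWord m) → Stab G₂ z w → Stab G₁ y w) →
      (i : Fin m) → Σ (Group.Carrier G₁) λ mᵢ → NormalClosureIn G₁ (Span G₁ (x ++ y)) x mᵢ ×
          Group._≈_ G₁ (lookup y′ i) (_^_ G₁ (lookup y i) mᵢ))
theorem3p5 G₁ G₂ n m x x′ y y′ z F₁∼F₂ z≉ε =
  (permutation , x′-conjugate) ,
  λ stab i → ConjugateIn-respʳ (Pointwise.lookup (stab braid z-fixed) i) (y′-conjugate i)
  where
  open Subgroups G₁

  x⊆Span : ∀ i → Span G₁ (x ++ y) (lookup x i)
  x⊆Span i = ∈-resp Gen-isSubgroup (Group.reflexive G₁ (≡.sym (lookup-++ˡ x y i)))
    (Span-lookup (x ++ y) (i ↑ˡ m))

  y⊆Span : ∀ i → Span G₁ (x ++ y) (lookup y i)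
  y⊆Span i = ∈-resp Gen-isSubgroup (Group.reflexive G₁ (≡.sym (lookup-++ʳ x y i)))
    (Span-lookup (x ++ y) (n ↑ʳ i))

  open NormalClosure Gen-isSubgroup x x⊆Span
  open Tracking G₁ G₂ Gen-isSubgroup Gen-isSubgroup NormalClosure⊆ NormalClosure-normal
  open HurwitzInvariants
    (hurwitzEquiv⇒invariants x x′ y y′ z NormalClosure-lookup y⊆Span z≉ε F₁∼F₂)
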